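{- Let $n\ge 3$ and let $S_n^2=S_{n-1}^2[1]\oplus S_{n-1}^2[2]\oplus\cdots\oplus S_{n-1}^2[n]$. Then any two vertices lying in different copies $S_{n-1}^2[i]\neq S_{n-1}^2[j]$ have at most one common outside neighbour.
   Context: Vertices of the symmetric group $\mathrm{Sym}(n)$ are written as strings $u=u_1u_2\cdots u_n$ (a permutation of $1,\dots,n$), and multiplying $u$ on the right by a transposition $(ij)$ swaps the entries in positions $i$ and $j$. The split-star network $S_n^2$ is the Cayley graph $\mathrm{Cay}(\mathrm{Sym}(n),T)$ with $T=\{(1i):2\le i\le n\}\cup\{(2i):3\le i\le n\}$, where $u$ is adjacent to $u\cdot s$ for $s\in T$. For $i\in[n]$, $S_{n-1}^2[i]$ is the subgraph induced by the vertices whose $n$-th entry is $i$ (a copy of $S_{n-1}^2$); $S_n^2=S_{n-1}^2[1]\oplus\cdots\oplus S_{n-1}^2[n]$ denotes this decomposition. An outside neighbour of a vertex $u\in V(S_{n-1}^2[i])$ is a neighbour of $u$ not in $S_{n-1}^2[i]$. -}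

module Defs where

open import Data.Nat using (ℕ; suc; _≤_)
open import Data.Fin using (Fin; toℕ)
open import Data.Vec using (Vec; lookup; _[_]≔_; last)
open import Data.Product using (Σ; _×_; _,_)
open import Data.Sum using (_⊎_)
open import Relation.Binary.PropositionalEquality using (_≡_; _≢_)

-- Vertices of Sym(n): strings u₁…uₙ, i.e. vectors of length n over Fin n
-- (entries 0..n-1 stand for 1..n, positions 0..n-1 stand for 1..n)
-- that are permutations (injective as position ↦ entry maps).
IsPerm : {n : ℕ} → Vec (Fin n) n → Set
IsPerm {n} u = (i j : Fin n) → lookup u i ≡ lookup u j → i ≡ j

swap : {n : ℕ} → Vec (Fin n) n → Fin n → Fin n → Vec (Fin n) n
swap u i j = (u [ i ]≔ lookup u j) [ j ]≔ lookup u i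

-- The generating set T = {(1 i) : 2 ≤ i ≤ n} ∪ {(2 i) : 3 ≤ i ≤ n},
-- in 0-based positions: {(0 b) : 1 ≤ b} ∪ {(1 b) : 2 ≤ b}.
InT : {n : ℕ} → Fin n → Fin n → Set
InT a b = (toℕ a ≡ 0 × 1 ≤ toℕ b) ⊎ (toℕ a ≡ 1 × 2 ≤ toℕ b)

-- Adjacency in the split-star network S_n^2 = Cay(Sym(n), T):
-- w = u · s for some s ∈ T.
Adj : {n : ℕ} → Vec (Fin n) n → Vec (Fin n) n → Set
Adj {n} u w = Σ (Fin n) λ a → Σ (Fin n) λ b → InT a b × w ≡ swap u a b

-- Copy index: u ∈ S_{n-1}^2[i] iff the n-th (last) entry of u is i.
copy : {m : ℕ} → Vec (Fin (suc m)) (suc m) → Fin (suc m)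
copy u = last u

OutsideNeighbour : {m : ℕ} → Vec (Fin (suc m)) (suc m) → Vec (Fin (suc m)) (suc m) → Set
OutsideNeighbour u w = Adj u w × copy w ≢ copy u

module Submission where

-- In S_n^2 the last position is moved only by the generators
-- (1 n) and (2 n), so an outside neighbour of u is u·(a n) with a ∈ {1,2}.
-- Let w be a common outside neighbour of u and v, taken from different copies:
-- w = u·(a n) = v·(b n).  Then a ≠ b, for otherwise u and v would both have
-- the entry w_a in their last position.  If w′ = u·(a′ n) = v·(b′ n) is a second
-- common outside neighbour, either a′ = a, and then w′ = u·(a n) = w, or the
-- two-element choice forces a′ = b and b′ = a.  In the latter ("crossed") case
-- w_a = v_a = w′_n = u_b = w_b, contradicting injectivity of w.

open import Defs
open import Data.Nat using (ℕ; suc; _≤_; s≤s; z≤n)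
open import Data.Fin using (Fin; zero; suc; fromℕ; _≟_)
open import Data.Vec using (Vec; _∷_; []; lookup; last; _[_]≔_)
open import Data.Vec.Properties using (lookup∘update; lookup∘update′)
open import Data.Bool using (Bool; true; false) renaming (_≟_ to _≟ᵇ_)
open import Data.Product using (Σ; _×_; _,_)
open import Data.Sum using (inj₁; inj₂)
open import Data.Empty using (⊥; ⊥-elim)
open import Relation.Nullary using (yes; no)
open import Relation.Binary.PropositionalEquality
  using (_≡_; _≢_; refl; sym; trans; cong; subst; module ≡-Reasoning)

last≡lookup-fromℕ : ∀ {A : Set} {n} (xs : Vec A (suc n)) → last xs ≡ lookup xs (fromℕ n)
last≡lookup-fromℕ (x ∷ [])     = refl
last≡lookup-fromℕ (x ∷ y ∷ xs) = last≡lookup-fromℕ (y ∷ xs)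

module Transposition {n : ℕ} where

  swap-at-second : (u : Vec (Fin n) n) (i j : Fin n) → lookup (swap u i j) j ≡ lookup u i
  swap-at-second u i j = lookup∘update j (u [ i ]≔ lookup u j) (lookup u i)

  swap-at-first : (u : Vec (Fin n) n) (i j : Fin n) → i ≢ j →
                  lookup (swap u i j) i ≡ lookup u j
  swap-at-first u i j i≢j =
    trans (lookup∘update′ i≢j (u [ i ]≔ lookup u j) (lookup u i))
          (lookup∘update i u (lookup u j))

  swap-elsewhere : (u : Vec (Fin n) n) (i j k : Fin n) → i ≢ k → j ≢ k →
                   lookup (swap u i j) k ≡ lookup u k
  swap-elsewhere u i j k i≢k j≢k =
    trans (lookup∘update′ (λ k≡j → j≢k (sym k≡j)) (u [ i ]≔ lookup u j) (lookup u i))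
          (lookup∘update′ (λ k≡i → i≢k (sym k≡i)) u (lookup u j))

  swap-fixes : (u w : Vec (Fin n) n) (i j l : Fin n) → i ≢ l → j ≢ l →
               w ≡ swap u i j → lookup w l ≡ lookup u l
  swap-fixes u .(swap u i j) i j l i≢l j≢l refl = swap-elsewhere u i j l i≢l j≢l

  same-transposition : (u v w : Vec (Fin n) n) (a l : Fin n) → a ≢ l →
                       w ≡ swap u a l → w ≡ swap v a l → lookup u l ≡ lookup v l
  same-transposition u v w a l a≢l w≡ua w≡va = begin
    lookup u l               ≡⟨ sym (swap-at-first u a l a≢l) ⟩
    lookup (swap u a l) a    ≡⟨ cong (λ z → lookup z a) (trans (sym w≡ua) w≡va) ⟩
    lookup (swap v a l) a    ≡⟨ swap-at-first v a l a≢l ⟩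
    lookup v l               ∎
    where open ≡-Reasoning

  no-crossing : (u v w w′ : Vec (Fin n) n) (a b l : Fin n) →
                a ≢ b → a ≢ l → b ≢ l → IsPerm w →
                w ≡ swap u a l → w ≡ swap v b l →
                w′ ≡ swap u b l → w′ ≡ swap v a l → ⊥
  no-crossing u v w w′ a b l a≢b a≢l b≢l perm-w w≡ua w≡vb w′≡ub w′≡va =
    a≢b (perm-w a b wa≡wb)
    where
    open ≡-Reasoning
    wa≡wb : lookup w a ≡ lookup w b
    wa≡wb = begin
      lookup w a   ≡⟨ swap-fixes v w b l a (λ b≡a → a≢b (sym b≡a)) (λ l≡a → a≢l (sym l≡a)) w≡vb ⟩
      lookup v a   ≡⟨ sym (trans (cong (λ z → lookup z l) w′≡va) (swap-at-second v a l)) ⟩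
      lookup w′ l  ≡⟨ trans (cong (λ z → lookup z l) w′≡ub) (swap-at-second u b l) ⟩
      lookup u b   ≡⟨ sym (swap-fixes u w a l b a≢b (λ l≡b → b≢l (sym l≡b)) w≡ua) ⟩
      lookup w b   ∎

open Transposition

bool-other : {c d e : Bool} → c ≢ d → e ≢ c → e ≡ d
bool-other {false} {false} c≢d _ = ⊥-elim (c≢d refl)
bool-other {true}  {true}  c≢d _ = ⊥-elim (c≢d refl)
bool-other {false} {true}  {false} _ e≢c = ⊥-elim (e≢c refl)
bool-other {false} {true}  {true}  _ _   = refl
bool-other {true}  {false} {false} _ _   = refl
bool-other {true}  {false} {true}  _ e≢c = ⊥-elim (e≢c refl)

module SplitStar (k : ℕ) where

  Vertex : Set
  Vertex = Vec (Fin (suc (suc (suc k)))) (suc (suc (suc k)))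

  lastPos : Fin (suc (suc (suc k)))
  lastPos = fromℕ (suc (suc k))

  front : Bool → Fin (suc (suc (suc k)))
  front false = zero
  front true  = suc zero

  front≢lastPos : ∀ c → front c ≢ lastPos
  front≢lastPos false ()
  front≢lastPos true  ()

  front-injective : ∀ {c d} → front c ≡ front d → c ≡ d
  front-injective {false} {false} _ = refl
  front-injective {true}  {true}  _ = refl
  front-injective {false} {true}  ()
  front-injective {true}  {false} ()

  generator-front : (a b : Fin (suc (suc (suc k)))) → InT a b → Σ Bool λ c → a ≡ front c
  generator-front zero          _ _ = false , refl
  generator-front (suc zero)    _ _ = true , refl
  generator-front (suc (suc a)) _ (inj₁ (() , _))
  generator-front (suc (suc a)) _ (inj₂ (() , _))

  -- An outside neighbour of u is u·(a n) with a a front position: a generator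
  -- avoiding position n would keep the last entry, hence the copy.
  outside-neighbour-form : (u w : Vertex) → OutsideNeighbour u w →
                           Σ Bool λ c → w ≡ swap u (front c) lastPos
  outside-neighbour-form u w ((a , b , a-b∈T , w≡uab) , other-copy)
    with generator-front a b a-b∈T
  ... | c , refl with b ≟ lastPos
  ...   | yes refl = c , w≡uab
  ...   | no b≢n = ⊥-elim (other-copy (begin
          last w                ≡⟨ last≡lookup-fromℕ w ⟩
          lookup w lastPos      ≡⟨ swap-fixes u w (front c) b lastPos (front≢lastPos c) b≢n w≡uab ⟩
          lookup u lastPos      ≡⟨ sym (last≡lookup-fromℕ u) ⟩
          last u                ∎))
    where open ≡-Reasoning

  CommonForm : Vertex → Vertex → Vertex → Set
  CommonForm u v w = Σ Bool λ c → Σ Bool λ d →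
                     c ≢ d × w ≡ swap u (front c) lastPos × w ≡ swap v (front d) lastPos

  common-outside-neighbour-form : (u v w : Vertex) → copy u ≢ copy v →
                                  OutsideNeighbour u w → OutsideNeighbour v w →
                                  CommonForm u v w
  common-outside-neighbour-form u v w u≉v u~w v~w
    with outside-neighbour-form u w u~w | outside-neighbour-form v w v~w
  ... | c , w≡uc | d , w≡vd = c , d , c≢d , w≡uc , w≡vd
    where
    c≢d : c ≢ d
    c≢d refl = u≉v (trans (last≡lookup-fromℕ u) (trans
                 (same-transposition u v w (front c) lastPos (front≢lastPos c) w≡uc w≡vd)
                 (sym (last≡lookup-fromℕ v))))

  -- Two such common outside neighbours coincide: if they use different front
  -- positions from u, they are in the crossed configuration.
  common-form-unique : (u v w w′ : Vertex) → IsPerm w →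
                       CommonForm u v w → CommonForm u v w′ → w ≡ w′
  common-form-unique u v w w′ perm-w (c , d , c≢d , w≡uc , w≡vd) (c′ , d′ , c′≢d′ , w′≡uc′ , w′≡vd′)
    with c ≟ᵇ c′
  ... | yes refl = trans w≡uc (sym w′≡uc′)
  ... | no c≢c′ = ⊥-elim (no-crossing u v w w′ (front c) (front d) lastPos
                    (λ e → c≢d (front-injective e)) (front≢lastPos c) (front≢lastPos d) perm-w
                    w≡uc w≡vd (subst (λ e → w′ ≡ swap u (front e) lastPos) c′≡d w′≡uc′)
                    (subst (λ e → w′ ≡ swap v (front e) lastPos) d′≡c w′≡vd′))
    where
    c′≡d : c′ ≡ d
    c′≡d = bool-other c≢d (λ e → c≢c′ (sym e))
    d′≡c : d′ ≡ c
    d′≡c = bool-other (λ e → c≢d (sym e)) (λ e → c′≢d′ (trans c′≡d (sym e)))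

lemma19 : (m : ℕ) → 3 ≤ suc m →
          (u v : Vec (Fin (suc m)) (suc m)) → IsPerm u → IsPerm v →
          copy u ≢ copy v →
          (w w′ : Vec (Fin (suc m)) (suc m)) → IsPerm w → IsPerm w′ →
          OutsideNeighbour u w → OutsideNeighbour v w →
          OutsideNeighbour u w′ → OutsideNeighbour v w′ →
          w ≡ w′
lemma19 (suc (suc k)) (s≤s (s≤s (s≤s z≤n))) u v _ _ u≉v w w′ perm-w _ u~w v~w u~w′ v~w′ =
  common-form-unique u v w w′ perm-w
    (common-outside-neighbour-form u v w u≉v u~w v~w)
    (common-outside-neighbour-form u v w′ u≉v u~w′ v~w′)
  where open SplitStar k
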